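{- Suppose that $D(\ell,q)=2^n$ for some integers $\ell\ge1$, $q\ge 0$, $n\ge 0$. Then $D(\ell+1,q)$ is finite and $D(\ell+1,q)\le 2^{n+1}$.
   Context: The EvenQuads-$2^n$ deck is the set $\mathbb{Z}_2^n$ ($n\ge 0$), whose elements are called cards. A quad is a set of four distinct cards $\vec a,\vec b,\vec c,\vec d$ with $\vec a+\vec b+\vec c+\vec d=\vec 0$. For a set $S$ of cards, the number of quads in $S$ is the number of 4-element subsets of $S$ that are quads. $D(\ell,q)$ denotes the smallest deck size $2^n$ such that there exists a set of $\ell$ distinct cards in $\mathbb{Z}_2^n$ containing exactly $q$ quads; if no such $n$ exists, $D(\ell,q)=\infty$. -}

module Defs where

open import Data.Nat using (ℕ; zero; suc; _<_)
open import Data.Bool using (Bool; true; false; _xor_)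
open import Data.Vec using (Vec; replicate; zipWith)
open import Data.List using (List; []; _∷_; length; map; filter; _++_; foldr)
open import Data.List.Relation.Unary.Unique.Propositional using (Unique)
open import Data.Product using (Σ; _×_; ∃)
open import Relation.Binary.PropositionalEquality using (_≡_)
open import Relation.Nullary using (¬_)
open import Data.Vec.Properties using (≡-dec)
open import Data.Bool.Properties using () renaming (_≟_ to _≟ᵇ_)

-- A card of the EvenQuads-2^n deck: an element of ℤ₂ⁿ, encoded as a Bool vector.
Card : ℕ → Set
Card n = Vec Bool n

0̂ : ∀ {n} → Card n
0̂ = replicate _ false

_⊕_ : ∀ {n} → Card n → Card n → Card n
_⊕_ = zipWith _xor_

Σcards : ∀ {n} → List (Card n) → Card n
Σcards = foldr _⊕_ 0̂

choose : ∀ {A : Set} → ℕ → List A → List (List A)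
choose zero    _        = [] ∷ []
choose (suc k) []       = []
choose (suc k) (x ∷ xs) = map (x ∷_) (choose k xs) ++ choose (suc k) xs

-- number of quads in a set S of distinct cards (given as a duplicate-free list):
-- the number of 4-element subsets whose sum is 0
numQuads : ∀ {n} → List (Card n) → ℕ
numQuads {n} S = length (filter (λ c → ≡-dec _≟ᵇ_ (Σcards c) 0̂) (choose 4 S))

Realizable : ℕ → ℕ → ℕ → Set
Realizable ℓ q n = Σ (List (Card n)) λ S → Unique S × length S ≡ ℓ × numQuads S ≡ q

-- D(ℓ,q) = 2^n : n is the least exponent for which (ℓ,q) is realizable
IsD : ℕ → ℕ → ℕ → Set
IsD ℓ q n = Realizable ℓ q n × (∀ m → m < n → ¬ Realizable ℓ q m)

-- Embed ℤ₂ⁿ in ℤ₂ⁿ⁺¹ as the hyperplane of cards with first coordinate 0; the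
-- embedding is an injective homomorphism, so it preserves the quads of a set.
-- Adding one card with first coordinate 1 creates no new quad, since every
-- 4-subset containing it has a sum with first coordinate 1.  Hence a realization
-- of (ℓ, q) in ℤ₂ⁿ gives one of (ℓ + 1, q) in ℤ₂ⁿ⁺¹.
module Submission where

open import Defs
open import Data.Nat using (ℕ; suc; _≤_; _+_)
open import Data.Nat.Properties using (≤-refl)
open import Data.Bool using (true; false)
open import Data.Bool.Properties using () renaming (_≟_ to _≟ᵇ_)
open import Data.Vec using (_∷_)
open import Data.Vec.Properties using (≡-dec; ∷-injectiveʳ)
open import Data.List using (List; []; _∷_; length; map; filter; _++_)
open import Data.List.Properties using (length-map; length-++; map-++; map-∘; filter-++; filter-none; filter-≐)
open import Data.List.Relation.Unary.All using (All; universal)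
import Data.List.Relation.Unary.All.Properties as All
open import Data.List.Relation.Unary.AllPairs using (_∷_)
open import Data.List.Relation.Unary.Unique.Propositional using (Unique)
import Data.List.Relation.Unary.Unique.Propositional.Properties as Unique
open import Data.Product using (Σ; _×_; _,_)
open import Function using (_∘_)
open import Level using (Level)
open import Relation.Binary.PropositionalEquality using (_≡_; refl; sym; trans; cong; cong₂; module ≡-Reasoning)
open import Relation.Nullary using (¬_; does)
open import Relation.Unary using (Pred; Decidable; _≐_)

private
  variable
    a b p : Level
    A B : Set a

filter-map : {P : Pred B p} (P? : Decidable P) (g : A → B) (xs : List A) →
  filter P? (map g xs) ≡ map g (filter (P? ∘ g) xs)
filter-map P? g []       = refl
filter-map P? g (x ∷ xs) with does (P? (g x))
... | true  = cong (g x ∷_) (filter-map P? g xs)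
... | false = filter-map P? g xs

choose-map : (g : A → B) (k : ℕ) (xs : List A) →
  choose k (map g xs) ≡ map (map g) (choose k xs)
choose-map g 0       xs       = refl
choose-map g (suc k) []       = refl
choose-map g (suc k) (x ∷ xs) = begin
  map (g x ∷_) (choose k (map g xs)) ++ choose (suc k) (map g xs)
    ≡⟨ cong₂ _++_ (trans (cong (map (g x ∷_)) (choose-map g k xs)) (sym (map-∘ (choose k xs))))
                  (choose-map g (suc k) xs) ⟩
  map ((g x ∷_) ∘ map g) (choose k xs) ++ map (map g) (choose (suc k) xs)
    ≡⟨ cong (_++ map (map g) (choose (suc k) xs)) (map-∘ (choose k xs)) ⟩
  map (map g) (map (x ∷_) (choose k xs)) ++ map (map g) (choose (suc k) xs)
    ≡⟨ sym (map-++ (map g) (map (x ∷_) (choose k xs)) (choose (suc k) xs)) ⟩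
  map (map g) (map (x ∷_) (choose k xs) ++ choose (suc k) xs) ∎
  where open ≡-Reasoning

sumsToZero? : ∀ {n} → Decidable {A = List (Card n)} (λ c → Σcards c ≡ 0̂)
sumsToZero? c = ≡-dec _≟ᵇ_ (Σcards c) 0̂

embed : ∀ {n} → Card n → Card (suc n)
embed = false ∷_

Σcards-map-embed : ∀ {n} (c : List (Card n)) → Σcards (map embed c) ≡ embed (Σcards c)
Σcards-map-embed []      = refl
Σcards-map-embed (x ∷ c) = cong (embed x ⊕_) (Σcards-map-embed c)

sumsToZero-map-embed : ∀ {n} →
  (λ (c : List (Card n)) → Σcards (map embed c) ≡ 0̂) ≐ (λ c → Σcards c ≡ 0̂)
sumsToZero-map-embed =
    (λ {c} eq → ∷-injectiveʳ (trans (sym (Σcards-map-embed c)) eq))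
  , (λ {c} eq → trans (Σcards-map-embed c) (cong embed eq))

numQuads-map-embed : ∀ {n} (S : List (Card n)) → numQuads (map embed S) ≡ numQuads S
numQuads-map-embed S = begin
  length (filter sumsToZero? (choose 4 (map embed S)))
    ≡⟨ cong (length ∘ filter sumsToZero?) (choose-map embed 4 S) ⟩
  length (filter sumsToZero? (map (map embed) (choose 4 S)))
    ≡⟨ cong length (filter-map sumsToZero? (map embed) (choose 4 S)) ⟩
  length (map (map embed) (filter (sumsToZero? ∘ map embed) (choose 4 S)))
    ≡⟨ length-map (map embed) (filter (sumsToZero? ∘ map embed) (choose 4 S)) ⟩
  length (filter (sumsToZero? ∘ map embed) (choose 4 S))
    ≡⟨ cong length (filter-≐ (sumsToZero? ∘ map embed) sumsToZero? sumsToZero-map-embed (choose 4 S)) ⟩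
  length (filter sumsToZero? (choose 4 S)) ∎
  where open ≡-Reasoning

Σcards-off-hyperplane : ∀ {n} (v : Card n) (c : List (Card n)) →
  ¬ Σcards ((true ∷ v) ∷ map embed c) ≡ 0̂
Σcards-off-hyperplane v c eq with trans (cong ((true ∷ v) ⊕_) (sym (Σcards-map-embed c))) eq
... | ()

numQuads-extend : ∀ {n} (v : Card n) (S : List (Card n)) →
  numQuads ((true ∷ v) ∷ map embed S) ≡ numQuads S
numQuads-extend v S = begin
  length (filter sumsToZero? (withNew ++ choose 4 (map embed S)))
    ≡⟨ cong length (filter-++ sumsToZero? withNew _) ⟩
  length (filter sumsToZero? withNew ++ filter sumsToZero? (choose 4 (map embed S)))
    ≡⟨ length-++ (filter sumsToZero? withNew) ⟩
  length (filter sumsToZero? withNew) + numQuads (map embed S)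
    ≡⟨ cong (λ xs → length xs + numQuads (map embed S)) (filter-none sumsToZero? noQuadWithNew) ⟩
  numQuads (map embed S)
    ≡⟨ numQuads-map-embed S ⟩
  numQuads S ∎
  where
  open ≡-Reasoning
  withNew = map ((true ∷ v) ∷_) (choose 3 (map embed S))
  noQuadWithNew : All (λ c → ¬ Σcards c ≡ 0̂) withNew
  noQuadWithNew rewrite choose-map embed 3 S =
    All.map⁺ (All.map⁺ (universal (Σcards-off-hyperplane v) (choose 3 S)))

realizable-extend : ∀ {ℓ q n} → Realizable ℓ q n → Realizable (suc ℓ) q (suc n)
realizable-extend {n = n} (S , unique , refl , refl) =
  new ∷ map embed S , unique′ , cong suc (length-map embed S) , numQuads-extend 0̂ S
  where
  new : Card (suc n)
  new = true ∷ 0̂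
  unique′ : Unique (new ∷ map embed S)
  unique′ = All.map⁺ (universal (λ _ ()) S) ∷ Unique.map⁺ ∷-injectiveʳ unique

proposition6 : (ℓ q n : ℕ) → 1 ≤ ℓ → IsD ℓ q n →
    Σ ℕ λ m → m ≤ suc n × Realizable (suc ℓ) q m
proposition6 ℓ q n _ (realizable , _) = suc n , ≤-refl , realizable-extend realizable
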